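{- For every store term $s$, location $\ell$ and values $V,W$: if $\vdash\mathrm{lkp}_\ell(s)=V$ and $\vdash\mathrm{lkp}_\ell(s)=W$, then $V\equiv W$ (syntactic identity, up to renaming of bound variables).
   Context: Fix a countably infinite set $\mathbf{L}$ of locations. Values are the terms $V ::= x\mid\lambda x.M$ of an untyped calculus, taken up to renaming of bound variables. Store terms $s ::= \mathrm{emp} \mid \mathrm{upd}_\ell(u,s)$ and lookup terms $u ::= V \mid \mathrm{lkp}_\ell(s)$ ($\ell\in\mathbf{L}$), where $\mathrm{lkp}_\ell(s)$ is well formed only if $\ell\in\mathrm{dom}(s)$; $\mathrm{dom}(\mathrm{emp})=\emptyset$, $\mathrm{dom}(\mathrm{upd}_\ell(u,s))=\{\ell\}\cup\mathrm{dom}(s)$. $\vdash a=b$ means the equation is derivable in equational logic (reflexivity, symmetry, transitivity, congruence) from: (1) $\mathrm{lkp}_\ell(\mathrm{upd}_\ell(u,s))=u$; (2) $\mathrm{lkp}_\ell(\mathrm{upd}_{\ell'}(u,s))=\mathrm{lkp}_\ell(s)$ if $\ell\neq\ell'$; (3) $\mathrm{upd}_\ell(\mathrm{lkp}_\ell(s),s)=s$; (4) $\mathrm{upd}_\ell(U,\mathrm{upd}_\ell(W,s))=\mathrm{upd}_\ell(U,s)$; (5) $\mathrm{upd}_\ell(U,\mathrm{upd}_{\ell'}(W,s))=\mathrm{upd}_{\ell'}(W,\mathrm{upd}_\ell(U,s))$ if $\ell\ne\ell'$ ($U,W$ values). -}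

module Defs where

open import Data.Nat using (ℕ)
open import Relation.Binary.PropositionalEquality using (_≡_; _≢_)

Loc : Set
Loc = ℕ

-- Values V ::= x | λx.M, with bound variables handled by de Bruijn indices,
-- so that syntactic identity up to renaming of bound variables is _≡_.
-- The syntax of the bodies M (the ambient untyped calculus) is left as an
-- arbitrary parameter Tm (the result holds uniformly in it).
data Val (Tm : Set) : Set where
  var : ℕ → Val Tm
  lam : Tm → Val Tm

mutual
  data Store (Tm : Set) : Set where
    emp : Store Tm
    upd : Loc → Lkp Tm → Store Tm → Store Tm

  data Lkp (Tm : Set) : Set where
    val : Val Tm → Lkp Tm
    lkp : Loc → Store Tm → Lkp Tm

data _∈dom_ {Tm : Set} (ℓ : Loc) : Store Tm → Set where
  here  : ∀ {u s} → ℓ ∈dom upd ℓ u s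
  there : ∀ {ℓ' u s} → ℓ ∈dom s → ℓ ∈dom upd ℓ' u s

mutual
  data WFs {Tm : Set} : Store Tm → Set where
    wf-emp : WFs emp
    wf-upd : ∀ {ℓ u s} → WFu u → WFs s → WFs (upd ℓ u s)

  data WFu {Tm : Set} : Lkp Tm → Set where
    wf-val : ∀ {V} → WFu (val V)
    wf-lkp : ∀ {ℓ s} → WFs s → ℓ ∈dom s → WFu (lkp ℓ s)

infix 4 ⊢s_≈_ ⊢u_≈_
mutual
  data ⊢s_≈_ {Tm : Set} : Store Tm → Store Tm → Set where
    s-refl  : ∀ {s} → WFs s → ⊢s_≈_ s s
    s-sym   : ∀ {s t} → ⊢s_≈_ s t → ⊢s_≈_ t s
    s-trans : ∀ {s t r} → ⊢s_≈_ s t → ⊢s_≈_ t r → ⊢s_≈_ s r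
    s-cong  : ∀ {ℓ u u' s s'} → ⊢u_≈_ u u' → ⊢s_≈_ s s' →
              ⊢s_≈_ (upd ℓ u s) (upd ℓ u' s')
    ax3 : ∀ {ℓ s} → WFs s → ℓ ∈dom s → ⊢s_≈_ (upd ℓ (lkp ℓ s) s) s
    ax4 : ∀ {ℓ U W s} → WFs s →
          ⊢s_≈_ (upd ℓ (val U) (upd ℓ (val W) s)) (upd ℓ (val U) s)
    ax5 : ∀ {ℓ ℓ' U W s} → ℓ ≢ ℓ' → WFs s →
          ⊢s_≈_ (upd ℓ (val U) (upd ℓ' (val W) s))
                 (upd ℓ' (val W) (upd ℓ (val U) s))

  data ⊢u_≈_ {Tm : Set} : Lkp Tm → Lkp Tm → Set where
    u-refl  : ∀ {u} → WFu u → ⊢u_≈_ u u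
    u-sym   : ∀ {u v} → ⊢u_≈_ u v → ⊢u_≈_ v u
    u-trans : ∀ {u v w} → ⊢u_≈_ u v → ⊢u_≈_ v w → ⊢u_≈_ u w
    u-cong  : ∀ {ℓ s s'} → ⊢s_≈_ s s' → ℓ ∈dom s → ℓ ∈dom s' →
              ⊢u_≈_ (lkp ℓ s) (lkp ℓ s')
    ax1 : ∀ {ℓ u s} → WFu u → WFs s → ⊢u_≈_ (lkp ℓ (upd ℓ u s)) u
    ax2 : ∀ {ℓ ℓ' u s} → ℓ ≢ ℓ' → WFu u → WFs s → ℓ ∈dom s →
          ⊢u_≈_ (lkp ℓ (upd ℓ' u s)) (lkp ℓ s)

-- A store denotes a partial map from locations to values, sending ℓ to the
-- value it was last updated with, and a lookup term denotes the value it
-- reads. Axioms (1)–(5) are the familiar laws of function update, and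
-- congruence preserves denotations, so provably equal terms have equal
-- denotations. A value denotes itself, hence two values provably equal to
-- the same lookup are identical.
module Submission where

open import Defs
open import Data.Nat using (_≟_)
open import Data.Maybe using (Maybe; just; nothing)
open import Data.Maybe.Properties using (just-injective)
open import Data.Empty using (⊥-elim)
open import Relation.Nullary using (yes; no)
open import Relation.Binary.PropositionalEquality

private
  variable
    B Tm : Set

update : Loc → B → (Loc → B) → Loc → B
update ℓ b f k with k ≟ ℓ
... | yes _ = b
... | no  _ = f k

update-≡ : ∀ ℓ (b : B) f → update ℓ b f ℓ ≡ b
update-≡ ℓ b f with ℓ ≟ ℓ
... | yes _  = refl
... | no ℓ≢ℓ = ⊥-elim (ℓ≢ℓ refl)

update-≢ : ∀ {k ℓ} (b : B) f → k ≢ ℓ → update ℓ b f k ≡ f k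
update-≢ {k = k} {ℓ} b f k≢ℓ with k ≟ ℓ
... | yes k≡ℓ = ⊥-elim (k≢ℓ k≡ℓ)
... | no  _   = refl

update-cong : ∀ ℓ {a b : B} {f g} → a ≡ b → f ≗ g → update ℓ a f ≗ update ℓ b g
update-cong ℓ a≡b f≗g k with k ≟ ℓ
... | yes _ = a≡b
... | no  _ = f≗g k

update-self : ∀ ℓ (f : Loc → B) → update ℓ (f ℓ) f ≗ f
update-self ℓ f k with k ≟ ℓ
... | yes refl = refl
... | no  _    = refl

update-update-≡ : ∀ ℓ (a b : B) f → update ℓ a (update ℓ b f) ≗ update ℓ a f
update-update-≡ ℓ a b f k with k ≟ ℓ
... | yes _   = refl
... | no  k≢ℓ = update-≢ b f k≢ℓ

update-update-≢ : ∀ {ℓ ℓ'} (a b : B) f → ℓ ≢ ℓ' →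
                  update ℓ a (update ℓ' b f) ≗ update ℓ' b (update ℓ a f)
update-update-≢ {ℓ = ℓ} {ℓ'} a b f ℓ≢ℓ' k with k ≟ ℓ | k ≟ ℓ'
... | yes refl | yes refl = ⊥-elim (ℓ≢ℓ' refl)
... | yes refl | no  _    = sym (update-≡ ℓ a f)
... | no  _    | yes refl = update-≡ ℓ' b f
... | no  k≢ℓ  | no  k≢ℓ' = trans (update-≢ b f k≢ℓ') (sym (update-≢ a f k≢ℓ))

mutual
  ⟦_⟧ₛ : Store Tm → Loc → Maybe (Val Tm)
  ⟦ emp       ⟧ₛ = λ _ → nothing
  ⟦ upd ℓ u s ⟧ₛ = update ℓ ⟦ u ⟧ᵤ ⟦ s ⟧ₛ

  ⟦_⟧ᵤ : Lkp Tm → Maybe (Val Tm)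
  ⟦ val V   ⟧ᵤ = just V
  ⟦ lkp ℓ s ⟧ᵤ = ⟦ s ⟧ₛ ℓ

mutual
  ⊢s-sound : {s t : Store Tm} → ⊢s s ≈ t → ⟦ s ⟧ₛ ≗ ⟦ t ⟧ₛ
  ⊢s-sound (s-refl _)                   k = refl
  ⊢s-sound (s-sym s≈t)                  k = sym (⊢s-sound s≈t k)
  ⊢s-sound (s-trans s≈t t≈r)            k = trans (⊢s-sound s≈t k) (⊢s-sound t≈r k)
  ⊢s-sound (s-cong {ℓ = ℓ} u≈u' s≈s')   = update-cong ℓ (⊢u-sound u≈u') (⊢s-sound s≈s')
  ⊢s-sound (ax3 {ℓ = ℓ} {s} _ _)        = update-self ℓ ⟦ s ⟧ₛ
  ⊢s-sound (ax4 {ℓ = ℓ} {U} {W} {s} _)  = update-update-≡ ℓ (just U) (just W) ⟦ s ⟧ₛ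
  ⊢s-sound (ax5 {U = U} {W} {s} ℓ≢ℓ' _) = update-update-≢ (just U) (just W) ⟦ s ⟧ₛ ℓ≢ℓ'

  ⊢u-sound : {u v : Lkp Tm} → ⊢u u ≈ v → ⟦ u ⟧ᵤ ≡ ⟦ v ⟧ᵤ
  ⊢u-sound (u-refl _)                   = refl
  ⊢u-sound (u-sym u≈v)                  = sym (⊢u-sound u≈v)
  ⊢u-sound (u-trans u≈v v≈w)            = trans (⊢u-sound u≈v) (⊢u-sound v≈w)
  ⊢u-sound (u-cong {ℓ = ℓ} s≈s' _ _)    = ⊢s-sound s≈s' ℓ
  ⊢u-sound (ax1 {ℓ = ℓ} {u} {s} _ _)    = update-≡ ℓ ⟦ u ⟧ᵤ ⟦ s ⟧ₛ
  ⊢u-sound (ax2 {u = u} {s} ℓ≢ℓ' _ _ _) = update-≢ ⟦ u ⟧ᵤ ⟦ s ⟧ₛ ℓ≢ℓ'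

mainTheorem9 : {Tm : Set} (s : Store Tm) (ℓ : Loc) (V W : Val Tm) →
    WFs s → ℓ ∈dom s →
    ⊢u lkp ℓ s ≈ val V → ⊢u lkp ℓ s ≈ val W → V ≡ W
mainTheorem9 s ℓ V W _ _ s≈V s≈W =
  just-injective (trans (sym (⊢u-sound s≈V)) (⊢u-sound s≈W))
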